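{- Let $G$ be a group and let $g\in G$ have finite order $o(g)$. Let $\mathcal{X}$ be a finite set of integers greater than $1$, and let $k$ be an integer with $2\leq k\leq o(g)$. Then there is a directed edge from $g$ to $g^k$ in the directed $\mathcal{X}$-excluded power graph $\vec{\mathcal{P}}_{ -\mathcal{X}}(G)$ if and only if no element of $\mathcal{X}$ divides $|\langle g\rangle:\langle g^k\rangle|=\gcd(k,o(g))$.
   Context: For a group $G$ and a set $\mathcal{X}$ of positive integers, the directed $\mathcal{X}$-excluded power graph $\vec{\mathcal{P}}_{ -\mathcal{X}}(G)$ has vertex set $G$ and a directed edge from $g$ to $h$ whenever $h\neq g$ and $h=g^k$ for some positive integer $k$ not divisible by any element of $\mathcal{X}$. $\langle g\rangle$ denotes the cyclic subgroup generated by $g$ and $o(g)$ its order. -}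

module Defs where

open import Level using (Level)
open import Algebra.Bundles using (Group)
open import Data.Nat using (ℕ; zero; suc; _<_; _≤_)
open import Data.Nat.Divisibility using (_∣_)
open import Data.List using (List)
open import Data.List.Membership.Propositional using (_∈_)
open import Data.Product using (_×_; ∃)
open import Relation.Nullary using (¬_)

module _ {c ℓ : Level} (G : Group c ℓ) where
  open Group G

  pow : Carrier → ℕ → Carrier
  pow g zero    = ε
  pow g (suc k) = g ∙ pow g k

  HasOrder : Carrier → ℕ → Set ℓ
  HasOrder g n = (0 < n) × (pow g n ≈ ε) × (∀ m → 0 < m → m < n → ¬ (pow g m ≈ ε))

  Edge : List ℕ → Carrier → Carrier → Set ℓ
  Edge X g h = ¬ (h ≈ g) × ∃ λ m → (0 < m) × (∀ x → x ∈ X → ¬ (x ∣ m)) × (h ≈ pow g m)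

-- If o(g) = n, then g^k = g^m exactly when k ≡ m (mod n), so every exponent m
-- realising g^k is a multiple of d = gcd(k, n); this gives the forward direction.
-- Conversely write k = d k′ and n = d n′ with k′, n′ coprime, and let t be the
-- largest divisor of L = ∏ X that is coprime to k′. Then k′ + t n′ is coprime to
-- L, so an element of X dividing m = k + t n = d (k′ + t n′) must divide d.
{-# OPTIONS --safe #-}
module Submission where

open import Defs
open import Level using (Level)
open import Algebra.Bundles using (Group)
open import Data.Nat using (ℕ; _<_; _≤_)
open import Data.Nat.Divisibility using (_∣_)
open import Data.Nat.GCD using (gcd)
open import Data.List using (List)
open import Data.List.Membership.Propositional using (_∈_)
open import Function.Bundles using (_⇔_)
open import Relation.Nullary using (¬_)

open import Data.Nat.Base using (zero; suc; _+_; _*_; _∸_; NonZero; >-nonZero; ≢-nonZero; ≢-nonZero⁻¹; z<s)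
open import Data.Nat.Properties
open import Data.Nat.Divisibility using (divides; ∣-trans; ∣m+n∣m⇒∣n; ∣m∣n⇒∣m+n; ∣n⇒∣m*n; ∣m⇒∣m*n; %-presˡ-∣)
open import Data.Nat.DivMod using (_%_; _/_; m≡m%n+[m/n]*n; m%n<n; m/n*n≡m)
open import Data.Nat.GCD using (gcd[m,n]∣m; gcd[m,n]∣n; gcd[m,n]≢0; gcd[m,n]≡0⇒m≡0)
open import Data.Nat.Coprimality as Coprimality using (Coprime; coprime?; coprime-divisor; coprime-/gcd; gcd≡1⇒coprime)
open import Data.Nat.Induction using (<-wellFounded)
open import Data.Nat.ListAction using (product)
open import Data.Nat.ListAction.Properties using (∈⇒∣product; product≢0)
open import Data.List.Relation.Unary.All using (tabulate)
open import Data.Product using (∃; _×_; _,_)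
open import Data.Sum using (inj₂)
open import Induction.WellFounded using (Acc; acc)
open import Relation.Nullary using (yes; no; contradiction)
open import Relation.Binary.Definitions using (tri<; tri≈; tri>)
open import Relation.Binary.PropositionalEquality as ≡ using (_≡_; cong; cong₂)
open import Function.Bundles using (mk⇔)
open import Function.Base using (_∘_)
import Algebra.Properties.Group as GroupProperties
import Relation.Binary.Reasoning.Setoid as SetoidReasoning

coprime-∣ʳ : ∀ {m n d} → Coprime m n → d ∣ n → Coprime m d
coprime-∣ʳ m⊥n d∣n (e∣m , e∣d) = m⊥n (e∣m , ∣-trans e∣d d∣n)

coprime-*ʳ : ∀ {m n o} → Coprime m n → Coprime m o → Coprime m (n * o)
coprime-*ʳ m⊥n m⊥o (e∣m , e∣no) =
  m⊥o (e∣m , coprime-divisor (Coprimality.sym (coprime-∣ʳ (Coprimality.sym m⊥n) e∣m)) e∣no)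

-- c′ is the largest divisor of c coprime to a.
coprime-part : ∀ a c .{{_ : NonZero c}} →
  ∃ λ c′ → Coprime c′ a × (∀ {u} → Coprime u a → Coprime u c′ → Coprime u c)
coprime-part a c = go c (<-wellFounded c)
  where
  go : ∀ c .{{_ : NonZero c}} → Acc _<_ c →
    ∃ λ c′ → Coprime c′ a × (∀ {u} → Coprime u a → Coprime u c′ → Coprime u c)
  go c _ with coprime? c a
  ... | yes c⊥a = c , c⊥a , λ _ u⊥c → u⊥c
  go c (acc rec) | no ¬c⊥a with gcd[m,n]∣m c a
  ... | divides c₁ c≡c₁g with go c₁ {{c₁≢0}} (rec c₁<c)
    where
    g = gcd c a
    c₁≢0 : NonZero c₁
    c₁≢0 = ≢-nonZero λ c₁≡0 → ≢-nonZero⁻¹ c (≡.trans c≡c₁g (cong (_* g) c₁≡0))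
    1<g : 1 < g
    1<g = ≤∧≢⇒< (n≢0⇒n>0 (≢-nonZero⁻¹ c ∘ gcd[m,n]≡0⇒m≡0)) (¬c⊥a ∘ gcd≡1⇒coprime ∘ ≡.sym)
    c₁<c : c₁ < c
    c₁<c = ≡.subst (c₁ <_) (≡.sym c≡c₁g) (m<m*n c₁ g {{c₁≢0}} 1<g)
  ... | c′ , c′⊥a , u⊥c₁ = c′ , c′⊥a , λ u⊥a u⊥c′ →
    ≡.subst (Coprime _) (≡.sym c≡c₁g) (coprime-*ʳ (u⊥c₁ u⊥a u⊥c′) (coprime-∣ʳ u⊥a (gcd[m,n]∣n c a)))

coprime-shift : ∀ {a b} → Coprime a b → ∀ L .{{_ : NonZero L}} → ∃ λ t → Coprime (a + t * b) L
coprime-shift {a} {b} a⊥b L with coprime-part a L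
... | t , t⊥a , ⊥L = t , ⊥L u⊥a u⊥t
  where
  u⊥a : Coprime (a + t * b) a
  u⊥a {e} (e∣u , e∣a) = a⊥b (e∣a , coprime-divisor e⊥t (∣m+n∣m⇒∣n e∣u e∣a))
    where e⊥t = Coprimality.sym (coprime-∣ʳ t⊥a e∣a)
  u⊥t : Coprime (a + t * b) t
  u⊥t {e} (e∣u , e∣t) = t⊥a (e∣t , ∣m+n∣m⇒∣n (≡.subst (e ∣_) (+-comm a (t * b)) e∣u) (∣m⇒∣m*n b e∣t))

gcd-shift : ∀ k n L .{{_ : NonZero n}} .{{_ : NonZero L}} →
  ∃ λ t → ∀ {x} → x ∣ L → x ∣ k + t * n → x ∣ gcd k n
gcd-shift k n L =
  let t , u⊥L = coprime-shift (coprime-/gcd k n) L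
  in t , λ {x} x∣L x∣m →
       coprime-divisor (Coprimality.sym (coprime-∣ʳ u⊥L x∣L)) (≡.subst (x ∣_) (m≡ud t) x∣m)
  where
  d = gcd k n
  instance
    d≢0 : NonZero d
    d≢0 = ≢-nonZero (gcd[m,n]≢0 k n (inj₂ (≢-nonZero⁻¹ n)))
  open ≡.≡-Reasoning
  m≡ud : ∀ t → k + t * n ≡ (k / d + t * (n / d)) * d
  m≡ud t = ≡.sym (begin
    (k / d + t * (n / d)) * d    ≡⟨ *-distribʳ-+ d (k / d) _ ⟩
    k / d * d + t * (n / d) * d  ≡⟨ cong₂ _+_ (m/n*n≡m (gcd[m,n]∣m k n)) (*-assoc t (n / d) d) ⟩
    k + t * (n / d * d)          ≡⟨ cong (λ z → k + t * z) (m/n*n≡m (gcd[m,n]∣n k n)) ⟩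
    k + t * n                    ∎)

∣-resp-≡-mod : ∀ {d n k m} .{{_ : NonZero n}} → d ∣ n → d ∣ k → k % n ≡ m % n → d ∣ m
∣-resp-≡-mod {d} {n} {k} {m} d∣n d∣k k≡m = ≡.subst (d ∣_) (≡.sym (m≡m%n+[m/n]*n m n))
  (∣m∣n⇒∣m+n (≡.subst (d ∣_) k≡m (%-presˡ-∣ d∣k d∣n)) (∣n⇒∣m*n (m / n) d∣n))

module _ {c ℓ : Level} (G : Group c ℓ) where
  open Group G
  open GroupProperties G using (∙-cancelˡ)

  private
    _^_ : Carrier → ℕ → Carrier
    g ^ k = pow G g k

  ^-+ : ∀ g a b → g ^ (a + b) ≈ g ^ a ∙ g ^ b
  ^-+ g zero    b = sym (identityˡ _)
  ^-+ g (suc a) b = trans (∙-congˡ (^-+ g a b)) (sym (assoc _ _ _))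

  ^-*-ε : ∀ {g n} → g ^ n ≈ ε → ∀ q → g ^ (q * n) ≈ ε
  ^-*-ε gⁿ≈ε zero    = refl
  ^-*-ε {g} {n} gⁿ≈ε (suc q) = begin
    g ^ (n + q * n)      ≈⟨ ^-+ g n (q * n) ⟩
    g ^ n ∙ g ^ (q * n)  ≈⟨ ∙-cong gⁿ≈ε (^-*-ε gⁿ≈ε q) ⟩
    ε ∙ ε                ≈⟨ identityˡ ε ⟩
    ε                    ∎
    where open SetoidReasoning setoid

  ^-+-multiple : ∀ {g n} → g ^ n ≈ ε → ∀ a q → g ^ (a + q * n) ≈ g ^ a
  ^-+-multiple {g} {n} gⁿ≈ε a q = begin
    g ^ (a + q * n)      ≈⟨ ^-+ g a (q * n) ⟩
    g ^ a ∙ g ^ (q * n)  ≈⟨ ∙-congˡ (^-*-ε gⁿ≈ε q) ⟩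
    g ^ a ∙ ε            ≈⟨ identityʳ _ ⟩
    g ^ a                ∎
    where open SetoidReasoning setoid

  ^-% : ∀ {g n} .{{_ : NonZero n}} → g ^ n ≈ ε → ∀ a → g ^ a ≈ g ^ (a % n)
  ^-% {g} {n} gⁿ≈ε a = trans (reflexive (cong (g ^_) (m≡m%n+[m/n]*n a n))) (^-+-multiple gⁿ≈ε (a % n) (a / n))

  order-^-distinct : ∀ {g n a b} → HasOrder G g n → a < b → b ∸ a < n → ¬ g ^ a ≈ g ^ b
  order-^-distinct {g} {n} {a} {b} (_ , _ , minimal) a<b b∸a<n gᵃ≈gᵇ =
    minimal (b ∸ a) (m<n⇒0<n∸m a<b) b∸a<n (∙-cancelˡ (g ^ a) _ _ (begin
      g ^ a ∙ g ^ (b ∸ a)  ≈⟨ ^-+ g a (b ∸ a) ⟨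
      g ^ (a + (b ∸ a))    ≡⟨ cong (g ^_) (m+[n∸m]≡n (<⇒≤ a<b)) ⟩
      g ^ b                ≈⟨ gᵃ≈gᵇ ⟨
      g ^ a                ≈⟨ identityʳ _ ⟨
      g ^ a ∙ ε            ∎))
    where open SetoidReasoning setoid

  ^-≈⇒%-≡ : ∀ {g n a b} .{{_ : NonZero n}} → HasOrder G g n → g ^ a ≈ g ^ b → a % n ≡ b % n
  ^-≈⇒%-≡ {g} {n} {a} {b} ord@(_ , gⁿ≈ε , _) gᵃ≈gᵇ with <-cmp (a % n) (b % n)
  ... | tri< lt _ _ = contradiction (trans (sym (^-% gⁿ≈ε a)) (trans gᵃ≈gᵇ (^-% gⁿ≈ε b)))
                        (order-^-distinct ord lt (≤-<-trans (m∸n≤m (b % n) (a % n)) (m%n<n b n)))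
  ... | tri≈ _ eq _ = eq
  ... | tri> _ _ gt = contradiction (trans (sym (^-% gⁿ≈ε b)) (trans (sym gᵃ≈gᵇ) (^-% gⁿ≈ε a)))
                        (order-^-distinct ord gt (≤-<-trans (m∸n≤m (a % n) (b % n)) (m%n<n a n)))

lemma3p1 : ∀ {c ℓ : Level} (G : Group c ℓ) (g : Group.Carrier G) (n : ℕ) →
    HasOrder G g n →
    (X : List ℕ) → (∀ x → x ∈ X → 1 < x) →
    (k : ℕ) → 2 ≤ k → k ≤ n →
    Edge G X g (pow G g k) ⇔ (∀ x → x ∈ X → ¬ (x ∣ gcd k n))
lemma3p1 G g n ord@(0<n , gⁿ≈ε , _) X X>1 k 2≤k k≤n = mk⇔ edge⇒ edge⇐
  where
  open Group G
  instance
    n≢0 : NonZero n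
    n≢0 = >-nonZero 0<n
    ∏X≢0 : NonZero (product X)
    ∏X≢0 = product≢0 (tabulate λ x∈X → >-nonZero (<-trans z<s (X>1 _ x∈X)))

  edge⇒ : Edge G X g (pow G g k) → ∀ x → x ∈ X → ¬ x ∣ gcd k n
  edge⇒ (_ , m , _ , X∤m , gᵏ≈gᵐ) x x∈X x∣d =
    X∤m x x∈X (∣-trans x∣d (∣-resp-≡-mod (gcd[m,n]∣n k n) (gcd[m,n]∣m k n) (^-≈⇒%-≡ G ord gᵏ≈gᵐ)))

  gᵏ≉g : ¬ pow G g k ≈ g
  gᵏ≉g gᵏ≈g = order-^-distinct G ord 2≤k (<-≤-trans (∸-monoʳ-< z<s (<⇒≤ 2≤k)) k≤n)
    (trans (identityʳ g) (sym gᵏ≈g))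

  edge⇐ : (∀ x → x ∈ X → ¬ x ∣ gcd k n) → Edge G X g (pow G g k)
  edge⇐ X∤d with gcd-shift k n (product X)
  ... | t , ∣∏X⇒∣d = gᵏ≉g , k + t * n , ≤-trans (<⇒≤ 2≤k) (m≤m+n k (t * n))
    , (λ x x∈X x∣m → X∤d x x∈X (∣∏X⇒∣d (∈⇒∣product x∈X) x∣m))
    , sym (^-+-multiple G gⁿ≈ε k t)
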